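{- Let $A$ be a finite set of atoms, $P$ a propositional Horn theory over $A$ and $I\subseteq A$. Let $I^\ominus=\{a\leftarrow a\mid a\in A\setminus I\}\cup\{a\leftarrow\ \mid a\in I\}$. Then $$P\circ I^\ominus=\{head(r)\leftarrow(body(r)\setminus I)\mid r\in P\}.$$
   Context: A theory over $A$ is a finite set of rules $a_0\leftarrow a_1,\ldots,a_k$ ($k\ge0$, $a_i\in A$), with $head(r)=\{a_0\}$, $body(r)=\{a_1,\ldots,a_k\}$, size $k$; $head(S),body(S)$ are unions over a set $S$ of rules. A rule with empty body is a fact (written $a\leftarrow$ or $a$). Write $S\subseteq_r R$ if $S\subseteq R$ has as many elements as the size of $r$. Composition: $P\circ R=\{head(r)\leftarrow body(S)\mid r\in P,\ S\subseteq_r R,\ head(S)=body(r)\}$. -}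

module Defs where

open import Data.Nat using (ℕ)
open import Data.Fin using (Fin)
open import Data.Fin.Subset as S using (Subset; ⋃; ⁅_⁆; ∣_∣; _─_; ⊥)
open import Data.Fin.Subset.Properties using (_∈?_)
open import Data.List using (List; []; _∷_; map; length; allFin)
open import Data.List.Membership.Propositional using () renaming (_∈_ to _∈ₗ_)
open import Data.List.Relation.Unary.All using (All)
open import Data.List.Relation.Unary.Unique.Propositional using (Unique)
open import Data.Product using (Σ; ∃; _×_; _,_)
open import Relation.Binary.PropositionalEquality using (_≡_)
open import Relation.Nullary using (yes; no)

-- Atoms: the finite set A is modelled as Fin n.
-- A (propositional Horn) rule a₀ ← a₁,…,aₖ : a single head atom and a finite set of body atoms.
record Rule (n : ℕ) : Set where
  constructor _←_
  field
    head : Fin n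
    body : Subset n
open Rule public

size : ∀ {n} → Rule n → ℕ
size r = ∣ body r ∣

-- A theory: a finite set of rules, given by a list (read as a set via membership).
Theory : ℕ → Set
Theory n = List (Rule n)

heads : ∀ {n} → List (Rule n) → Subset n
heads S = ⋃ (map (λ s → ⁅ head s ⁆) S)

bodies : ∀ {n} → List (Rule n) → Subset n
bodies S = ⋃ (map body S)

-- S ⊆_r R : S is a subset of R with exactly size(r) elements
-- (S is a duplicate-free list, so its length is its cardinality).
_⊆[_]_ : ∀ {n} → List (Rule n) → Rule n → Theory n → Set
S ⊆[ r ] R = Unique S × All (_∈ₗ R) S × length S ≡ size r

_∈∘[_,_] : ∀ {n} → Rule n → Theory n → Theory n → Set
q ∈∘[ P , R ] =
  Σ (Rule _) λ r → r ∈ₗ P × Σ (List (Rule _)) λ S →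
    S ⊆[ r ] R × heads S ≡ body r × q ≡ (head r ← bodies S)

Iminus : ∀ {n} → Subset n → Theory n
Iminus {n} I = map f (allFin n)
  where
  f : Fin n → Rule n
  f a with a ∈? I
  ... | yes _ = a ← ⊥
  ... | no  _ = a ← ⁅ a ⁆

-- A rule of I^⊖ with head a has body ⁅ a ⁆ ─ I, so any set S of such rules
-- satisfies bodies S = heads S ─ I.  A composed rule of P ∘ I^⊖ comes from some
-- r ∈ P and such an S with heads S = body r, so its body is body r ─ I.
-- Conversely, for r ∈ P the rules of I^⊖ whose heads are the atoms of body r
-- form a suitable S: one rule per body atom, so |S| = size r.
module Submission where

open import Defs
open import Data.Nat using (ℕ; suc)
open import Data.Fin using (Fin; zero; suc)
open import Data.Fin.Properties using (suc-injective)
open import Data.Fin.Subset using (Subset; _─_; ⊥; ⁅_⁆; ⋃; ∣_∣; inside; outside)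
  renaming (_∈_ to _∈ₛ_; _∉_ to _∉ₛ_)
open import Data.Fin.Subset.Properties
  using (_∈?_; ⊆-antisym; ∉⊥; x∈⁅x⁆; x∈⁅y⁆⇒x≡y; x∈p∪q⁻; x∈p∪q⁺; x∈p∧x∉q⇒x∈p─q; p─q⊆p)
open import Data.Vec using ([]; _∷_; here; there)
open import Data.List using (List; []; _∷_; map; length; allFin)
open import Data.List.Properties using (length-map)
open import Data.List.Membership.Propositional using (_∈_)
open import Data.List.Membership.Propositional.Properties using (∈-map⁺; ∈-map⁻; ∈-allFin)
open import Data.List.Relation.Unary.Any using (here; there)
open import Data.List.Relation.Unary.All as All using (All)
open import Data.List.Relation.Unary.All.Properties as All using ()
open import Data.List.Relation.Unary.AllPairs using ([]; _∷_)
open import Data.List.Relation.Unary.Unique.Propositional using (Unique)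
import Data.List.Relation.Unary.Unique.Propositional.Properties as Unique
open import Data.Product using (Σ; _×_; _,_; ∃)
open import Data.Sum using (inj₁; inj₂)
open import Function.Base using (_∋_)
open import Function.Bundles using (_⇔_; mk⇔)
open import Relation.Binary.PropositionalEquality using (_≡_; refl; sym; trans; cong; subst)
open import Relation.Nullary using (¬_; yes; no; contradiction)

private
  variable
    n : ℕ
    x : Fin n

x∈p─q⇒x∉q : ∀ (p q : Subset n) → x ∈ₛ p ─ q → x ∉ₛ q
x∈p─q⇒x∉q (_ ∷ p) (inside  ∷ q) (there x∈p─q) (there x∈q) = x∈p─q⇒x∉q p q x∈p─q x∈q
x∈p─q⇒x∉q (_ ∷ p) (outside ∷ q) (there x∈p─q) (there x∈q) = x∈p─q⇒x∉q p q x∈p─q x∈q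

module _ {A : Set} (f : A → Subset n) where

  ∈-⋃-map⁻ : ∀ xs → x ∈ₛ ⋃ (map f xs) → ∃ λ a → a ∈ xs × x ∈ₛ f a
  ∈-⋃-map⁻ []       x∈ = contradiction x∈ ∉⊥
  ∈-⋃-map⁻ (a ∷ xs) x∈ with x∈p∪q⁻ (f a) (⋃ (map f xs)) x∈
  ... | inj₁ x∈fa = a , here refl , x∈fa
  ... | inj₂ x∈⋃  with ∈-⋃-map⁻ xs x∈⋃
  ...   | b , b∈xs , x∈fb = b , there b∈xs , x∈fb

  ∈-⋃-map⁺ : ∀ {a} xs → a ∈ xs → x ∈ₛ f a → x ∈ₛ ⋃ (map f xs)
  ∈-⋃-map⁺ (a ∷ xs) (here refl) x∈fa = x∈p∪q⁺ (inj₁ x∈fa)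
  ∈-⋃-map⁺ (b ∷ xs) (there a∈xs) x∈fa = x∈p∪q⁺ {p = f b} (inj₂ (∈-⋃-map⁺ xs a∈xs x∈fa))

∈-heads⁻ : ∀ (S : List (Rule n)) → x ∈ₛ heads S → ∃ λ s → s ∈ S × head s ≡ x
∈-heads⁻ S x∈ with ∈-⋃-map⁻ (λ s → ⁅ head s ⁆) S x∈
... | s , s∈S , x∈⁅hs⁆ = s , s∈S , sym (x∈⁅y⁆⇒x≡y _ x∈⁅hs⁆)

∈-heads⁺ : ∀ {s : Rule n} S → s ∈ S → head s ∈ₛ heads S
∈-heads⁺ {s = s} S s∈S = ∈-⋃-map⁺ (λ s → ⁅ head s ⁆) S s∈S (x∈⁅x⁆ (head s))

∈-bodies⁻ : ∀ (S : List (Rule n)) → x ∈ₛ bodies S → ∃ λ s → s ∈ S × x ∈ₛ body s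
∈-bodies⁻ = ∈-⋃-map⁻ body

∈-bodies⁺ : ∀ {s : Rule n} S → s ∈ S → x ∈ₛ body s → x ∈ₛ bodies S
∈-bodies⁺ = ∈-⋃-map⁺ body

elements : Subset n → List (Fin n)
elements []            = []
elements (inside  ∷ p) = zero ∷ map suc (elements p)
elements (outside ∷ p) = map suc (elements p)

elements-unique : ∀ (p : Subset n) → Unique (elements p)
elements-unique []            = []
elements-unique (inside  ∷ p) = zero∉ (elements p) ∷ Unique.map⁺ suc-injective (elements-unique p)
  where
  zero∉ : ∀ (xs : List (Fin n)) → All (λ y → ¬ zero ≡ y) (map suc xs)
  zero∉ xs = All.map⁺ (All.universal (λ _ ()) xs)
elements-unique (outside ∷ p) = Unique.map⁺ suc-injective (elements-unique p)

length-elements : ∀ (p : Subset n) → length (elements p) ≡ ∣ p ∣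
length-elements []            = refl
length-elements (inside  ∷ p) = cong suc (trans (length-map suc (elements p)) (length-elements p))
length-elements (outside ∷ p) = trans (length-map suc (elements p)) (length-elements p)

∈-elements⁻ : ∀ (p : Subset n) → x ∈ elements p → x ∈ₛ p
∈-elements⁻ (inside  ∷ p) (here refl) = here
∈-elements⁻ (inside  ∷ p) (there x∈)  with ∈-map⁻ suc x∈
... | _ , y∈ , refl = there (∈-elements⁻ p y∈)
∈-elements⁻ (outside ∷ p) x∈          with ∈-map⁻ suc x∈
... | _ , y∈ , refl = there (∈-elements⁻ p y∈)

∈-elements⁺ : ∀ (p : Subset n) → x ∈ₛ p → x ∈ elements p
∈-elements⁺ (inside  ∷ p) here       = here refl
∈-elements⁺ (inside  ∷ p) (there x∈) = there (∈-map⁺ suc (∈-elements⁺ p x∈))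
∈-elements⁺ (outside ∷ p) (there x∈) = ∈-map⁺ suc (∈-elements⁺ p x∈)

-- The same case split as the rule-builder local to Iminus, which cannot be named.
unitRule : Subset n → Fin n → Rule n
unitRule I a with a ∈? I
... | yes _ = a ← ⊥
... | no  _ = a ← ⁅ a ⁆

module _ (I : Subset n) where

  head-unitRule : ∀ a → head (unitRule I a) ≡ a
  head-unitRule a with a ∈? I
  ... | yes _ = refl
  ... | no  _ = refl

  unitRule-injective : ∀ {a b} → unitRule I a ≡ unitRule I b → a ≡ b
  unitRule-injective {a} {b} eq =
    trans (sym (head-unitRule a)) (trans (cong head eq) (head-unitRule b))

  ∈-body-unitRule⁻ : ∀ a → x ∈ₛ body (unitRule I a) → x ≡ a × x ∉ₛ I
  ∈-body-unitRule⁻ a x∈ with a ∈? I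
  ... | yes _   = contradiction x∈ ∉⊥
  ... | no  a∉I with x∈⁅y⁆⇒x≡y a x∈
  ...   | refl = refl , a∉I

  ∈-body-unitRule⁺ : x ∉ₛ I → x ∈ₛ body (unitRule I x)
  ∈-body-unitRule⁺ {x = x} x∉I with x ∈? I
  ... | yes x∈I = contradiction x∈I x∉I
  ... | no  _   = x∈⁅x⁆ x

  -- Abstracting over a ∈? I also abstracts it inside the type of the second
  -- term, which mentions the builder of Iminus applied to a.
  unitRule∈Iminus : ∀ a → unitRule I a ∈ Iminus I
  unitRule∈Iminus a with a ∈? I | (_ ∈ Iminus I) ∋ ∈-map⁺ _ (∈-allFin a)
  ... | yes _ | a∈ = a∈
  ... | no  _ | a∈ = a∈

  unitRule-inside : ∀ {a} → a ∈ₛ I → unitRule I a ≡ (a ← ⊥)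
  unitRule-inside {a} a∈I with a ∈? I
  ... | yes _   = refl
  ... | no  a∉I = contradiction a∈I a∉I

  unitRule-outside : ∀ {a} → a ∉ₛ I → unitRule I a ≡ (a ← ⁅ a ⁆)
  unitRule-outside {a} a∉I with a ∈? I
  ... | yes a∈I = contradiction a∈I a∉I
  ... | no  _   = refl

  ∈Iminus⇒≡unitRule : ∀ {s} → s ∈ Iminus I → s ≡ unitRule I (head s)
  ∈Iminus⇒≡unitRule s∈ with ∈-map⁻ _ s∈
  ... | a , _ , refl with a ∈? I
  ...   | yes a∈I = sym (unitRule-inside a∈I)
  ...   | no  a∉I = sym (unitRule-outside a∉I)

  bodies≡heads─I : ∀ S → All (_∈ Iminus I) S → bodies S ≡ heads S ─ I
  bodies≡heads─I S S⊆I⊖ = ⊆-antisym bodies⊆ ⊆bodies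
    where
    bodies⊆ : ∀ {x} → x ∈ₛ bodies S → x ∈ₛ heads S ─ I
    bodies⊆ x∈ with ∈-bodies⁻ S x∈
    ... | s , s∈S , x∈bs
      with ∈-body-unitRule⁻ (head s)
             (subst (λ t → _ ∈ₛ body t) (∈Iminus⇒≡unitRule (All.lookup S⊆I⊖ s∈S)) x∈bs)
    ...   | refl , x∉I = x∈p∧x∉q⇒x∈p─q (∈-heads⁺ S s∈S) x∉I
    ⊆bodies : ∀ {x} → x ∈ₛ heads S ─ I → x ∈ₛ bodies S
    ⊆bodies x∈ with ∈-heads⁻ S (p─q⊆p (heads S) I x∈)
    ... | s , s∈S , refl =
      ∈-bodies⁺ S s∈S
        (subst (λ t → _ ∈ₛ body t) (sym (∈Iminus⇒≡unitRule (All.lookup S⊆I⊖ s∈S)))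
          (∈-body-unitRule⁺ (x∈p─q⇒x∉q (heads S) I x∈)))

  heads≡⇒bodies≡─I : ∀ {S p} → All (_∈ Iminus I) S → heads S ≡ p → bodies S ≡ p ─ I
  heads≡⇒bodies≡─I {S} S⊆I⊖ heads≡p = trans (bodies≡heads─I S S⊆I⊖) (cong (_─ I) heads≡p)

  unitRules : Subset n → List (Rule n)
  unitRules p = map (unitRule I) (elements p)

  unitRules⊆Iminus : ∀ r → unitRules (body r) ⊆[ r ] Iminus I
  unitRules⊆Iminus r =
      Unique.map⁺ unitRule-injective (elements-unique (body r))
    , All.map⁺ (All.universal unitRule∈Iminus (elements (body r)))
    , trans (length-map (unitRule I) (elements (body r))) (length-elements (body r))

  heads-unitRules : ∀ p → heads (unitRules p) ≡ p
  heads-unitRules p = ⊆-antisym heads⊆ ⊆heads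
    where
    heads⊆ : ∀ {x} → x ∈ₛ heads (unitRules p) → x ∈ₛ p
    heads⊆ x∈ with ∈-heads⁻ (unitRules p) x∈
    ... | s , s∈ , refl with ∈-map⁻ (unitRule I) s∈
    ...   | a , a∈ , refl = subst (_∈ₛ p) (sym (head-unitRule a)) (∈-elements⁻ p a∈)
    ⊆heads : ∀ {x} → x ∈ₛ p → x ∈ₛ heads (unitRules p)
    ⊆heads {x} x∈ =
      subst (_∈ₛ heads (unitRules p)) (head-unitRule x)
        (∈-heads⁺ (unitRules p) (∈-map⁺ (unitRule I) (∈-elements⁺ p x∈)))

proposition4p4 : (n : ℕ) (P : Theory n) (I : Subset n) (q : Rule n) →
    (q ∈∘[ P , Iminus I ]) ⇔ Σ (Rule n) (λ r → r ∈ P × q ≡ (head r ← (body r ─ I)))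
proposition4p4 n P I q = mk⇔ composed⇒reduct reduct⇒composed
  where
  composed⇒reduct : q ∈∘[ P , Iminus I ] → Σ (Rule n) (λ r → r ∈ P × q ≡ (head r ← (body r ─ I)))
  composed⇒reduct (r , r∈P , S , (_ , S⊆I⊖ , _) , heads≡body , refl) =
    r , r∈P , cong (head r ←_) (heads≡⇒bodies≡─I I S⊆I⊖ heads≡body)

  reduct⇒composed : Σ (Rule n) (λ r → r ∈ P × q ≡ (head r ← (body r ─ I))) → q ∈∘[ P , Iminus I ]
  reduct⇒composed (r , r∈P , refl) with unitRules⊆Iminus I r | heads-unitRules I (body r)
  ... | S⊆r@(_ , S⊆I⊖ , _) | heads≡body =
    r , r∈P , unitRules I (body r) , S⊆r , heads≡body ,
    cong (head r ←_) (sym (heads≡⇒bodies≡─I I S⊆I⊖ heads≡body))
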